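{- Let $k\ge2$ and $n>2^k$ be integers and $c=2^k-2$. For every $v\in V\setminus\{1\}$ there exists a search strategy $T_v\in\mathcal T_k$ with $$C(T_v)=\begin{cases}[v\oplus(c+1)] & \text{if } \{0,n-1\}\cap[v\oplus(c+1)]\ne\emptyset,\\ [v\oplus c] & \text{otherwise.}\end{cases}$$
   Context: Let $G$ be the path with vertex set $V=\{0,\dots,n-1\}$ and edges $\{v,v+1\}$, $0\le v\le n-2$. A search strategy for a tree $H$ is a rooted binary tree whose internal nodes are labeled by edges of $H$, defined recursively: a single node is a search strategy for any tree; otherwise the root is labeled by an edge $uv$ of $H$ and its two subtrees are search strategies for the connected components of $H-uv$ containing $u$ and $v$. Nodes carry vertex sets: the root gets $V(H)$ and recursively the subtree roots get the vertex sets of those components. The covered set $C(T)$ is the set of $v$ such that $\{v\}$ is the vertex set of some leaf. $\mathcal T_k$ is the set of search strategies for $G$ of height (max number of edges on a root-to-leaf path) at most $k$. Interval notation: $[u,v]_n=\{z\bmod n:u\le z\le v\}$ if $u\le v$, else $\emptyset$; $[v\oplus\ell]=[v,v+\ell-1]_n$. -}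

module Defs where

open import Data.Nat using (ℕ; zero; suc; _+_; _∸_; _≤_; _<_; _⊔_; NonZero)
open import Data.Nat.DivMod using (_%_)
open import Data.Product using (Σ; _×_; ∃)
open import Data.Sum using (_⊎_)
open import Relation.Binary.PropositionalEquality using (_≡_)

-- Every connected subtree of the path G = 0 - 1 - ... - (n-1) is a subpath
-- with vertex set an interval {a,...,b}.  A search strategy for the subpath
-- [a,b]: either a single node (leaf), or a root labelled by an edge {e,e+1}
-- of the subpath (a ≤ e < b) with subtrees being search strategies for the
-- two components [a,e] and [e+1,b] of the subpath minus that edge.
data Strategy (a b : ℕ) : Set where
  leaf : Strategy a b
  node : (e : ℕ) → a ≤ e → e < b → Strategy a e → Strategy (suc e) b → Strategy a b

height : ∀ {a b} → Strategy a b → ℕ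
height leaf = 0
height (node e _ _ l r) = suc (height l ⊔ height r)

-- x ∈ C(T): some leaf carries the vertex set {x}
-- (a leaf of a strategy for [a,b] carries the vertex set {a,...,b}).
Covered : ∀ {a b} → Strategy a b → ℕ → Set
Covered {a} {b} leaf x = (a ≡ x) × (b ≡ x)
Covered (node e _ _ l r) x = Covered l x ⊎ Covered r x

StrategyG : ℕ → Set
StrategyG n = Strategy 0 (n ∸ 1)

InInterval : (n : ℕ) → .{{NonZero n}} → ℕ → ℕ → ℕ → Set
InInterval n u w x = (u ≤ w) × ∃ λ z → (u ≤ z) × (z ≤ w) × (z % n ≡ x)

-- membership in [v ⊕ ℓ] = [v, v+ℓ-1]_n   (we only use ℓ ≥ 1)
InSeg : (n : ℕ) → .{{NonZero n}} → ℕ → ℕ → ℕ → Set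
InSeg n v ℓ x = InInterval n v (v + ℓ ∸ 1) x

CoveredSetIs : ∀ {a b} → Strategy a b → (ℕ → Set) → Set
CoveredSetIs T S = ∀ x → (Covered T x → S x) × (S x → Covered T x)

-- A subpath on at most 2^h vertices is covered completely in height h by cutting off a block of 2^(h-1) vertices.
-- More generally, let a subpath consist of a covered prefix, an uncovered gap of at least two vertices and a covered
-- suffix, with fewer than 2^h covered vertices in total. Then height h suffices: cut off a full block of 2^(h-1)
-- vertices from the prefix if it is that long, and otherwise a block of at most 2^(h-1) vertices from the end of the
-- suffix, and recurse. If [v ⊕ (c+1)] meets an end of the path, it has this shape in [0, n-1] (wrapping around modulo
-- n if necessary) with 2^k - 1 covered vertices. Otherwise the c = 2 (2^(k-1) - 1) vertices of [v ⊕ c] are split at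
-- the root in the middle, leaving a covered suffix of the left part and a covered prefix of the right part, of
-- 2^(k-1) - 1 vertices each; v ≠ 1 makes the gap {0, ..., v-1} in front of the segment at least two vertices long.
module Submission where

open import Defs
open import Data.Nat using (ℕ; _+_; _∸_; _^_; _≤_; _<_; NonZero)
open import Data.Product using (Σ; _×_; ∃)
open import Data.Sum using (_⊎_)
open import Relation.Nullary using (¬_)
open import Relation.Binary.PropositionalEquality using (_≡_)

open import Data.Empty using (⊥-elim)
open import Data.Nat using (zero; suc; z≤n; s≤s; _≤?_)
open import Data.Nat.DivMod using (_%_; m<n⇒m%n≡m; [m+n]%n≡m%n)
open import Data.Nat.Properties
open import Data.Nat.Tactic.RingSolver using (solve-∀)
open import Data.Product using (_,_; proj₁; proj₂; map₂)
open import Data.Sum using (inj₁; inj₂; [_,_])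
import Data.Sum as Sum
open import Level using (0ℓ)
open import Relation.Binary.PropositionalEquality using (refl; sym; trans; cong; subst; module ≡-Reasoning)
open import Relation.Nullary using (yes; no)
open import Relation.Unary using (Pred; Empty; _∪_; _≐_)
open import Relation.Unary.Algebra using (∪-assoc; ∪-cong)
open import Relation.Unary.Properties using (≐-refl; ≐-sym; ≐-trans)

variable
  a b e l r h k : ℕ
  P Q : Pred ℕ 0ℓ

-- Ioc a b is definitionally Icc (suc a) b, which is used silently throughout.
Icc Ico Ioc : ℕ → ℕ → Pred ℕ 0ℓ
Icc a b x = a ≤ x × x ≤ b
Ico a b x = a ≤ x × x < b
Ioc a b x = a < x × x ≤ b

Icc-split : a ≤ suc e → e ≤ b → Icc a b ≐ Icc a e ∪ Icc (suc e) b
Icc-split {a = a} {e = e} {b = b} a≤1+e e≤b = split , [ (λ (a≤x , x≤e) → a≤x , ≤-trans x≤e e≤b)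
                                                    , (λ (e<x , x≤b) → ≤-trans a≤1+e e<x , x≤b) ]
  where
  split : ∀ {x} → Icc a b x → (Icc a e ∪ Icc (suc e) b) x
  split {x} (a≤x , x≤b) with x ≤? e
  ... | yes x≤e = inj₁ (a≤x , x≤e)
  ... | no x≰e = inj₂ (≰⇒> x≰e , x≤b)

Ico-split : a ≤ suc e → e < b → Ico a b ≐ Icc a e ∪ Ico (suc e) b
Ico-split {a = a} {e = e} {b = b} a≤1+e e<b = split , [ (λ (a≤x , x≤e) → a≤x , ≤-<-trans x≤e e<b)
                                                    , (λ (e<x , x<b) → ≤-trans a≤1+e e<x , x<b) ]
  where
  split : ∀ {x} → Ico a b x → (Icc a e ∪ Ico (suc e) b) x
  split {x} (a≤x , x<b) with x ≤? e
  ... | yes x≤e = inj₁ (a≤x , x≤e)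
  ... | no x≰e = inj₂ (≰⇒> x≰e , x<b)

Ico-suc : Ico a (suc b) ≐ Icc a b
Ico-suc = map₂ ≤-pred , map₂ s≤s

Ico-Empty : b ≤ a → Empty (Ico a b)
Ico-Empty b≤a x (a≤x , x<b) = <⇒≱ x<b (≤-trans b≤a a≤x)

Ioc-Empty : b ≤ a → Empty (Ioc a b)
Ioc-Empty b≤a x (a<x , x≤b) = <⇒≱ a<x (≤-trans x≤b b≤a)

∪-identityˡ-Empty : Empty P → P ∪ Q ≐ Q
∪-identityˡ-Empty empty = (λ {x} → [ (λ Px → ⊥-elim (empty x Px)) , (λ Qx → Qx) ]) , inj₂

∪-identityʳ-Empty : Empty Q → P ∪ Q ≐ P
∪-identityʳ-Empty empty = (λ {x} → [ (λ Px → Px) , (λ Qx → ⊥-elim (empty x Qx)) ]) , inj₁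

m+[n∸o]≤p : ∀ {m n p} o → m ≤ p → m + n ≤ o + p → m + (n ∸ o) ≤ p
m+[n∸o]≤p {m} {n} {p} o m≤p m+n≤o+p with o ≤? n
... | no o≰n rewrite m≤n⇒m∸n≡0 (<⇒≤ (≰⇒> o≰n)) | +-identityʳ m = m≤p
... | yes o≤n = begin
  m + (n ∸ o) ≡⟨ +-∸-assoc m o≤n ⟨
  m + n ∸ o   ≤⟨ ∸-monoˡ-≤ o m+n≤o+p ⟩
  o + p ∸ o   ≡⟨ m+n∸m≡n o p ⟩
  p           ∎
  where open ≤-Reasoning

mersenne : ℕ → ℕ
mersenne zero = 0
mersenne (suc h) = suc (mersenne h + mersenne h)

2^≡1+mersenne : ∀ h → 2 ^ h ≡ suc (mersenne h)
2^≡1+mersenne zero = refl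
2^≡1+mersenne (suc h) rewrite 2^≡1+mersenne h | +-identityʳ (mersenne h) =
  cong suc (+-suc (mersenne h) (mersenne h))

Coverable : ℕ → ℕ → ℕ → Pred ℕ 0ℓ → Set
Coverable h a b P = Σ (Strategy a b) λ T → height T ≤ h × CoveredSetIs T P

coverable-mono : h ≤ k → Coverable h a b P → Coverable k a b P
coverable-mono h≤k (T , hT , covT) = T , ≤-trans hT h≤k , covT

coverable-≐ : P ≐ Q → Coverable h a b P → Coverable h a b Q
coverable-≐ (P⊆Q , Q⊆P) (T , hT , covT) = T , hT , λ x → (λ c → P⊆Q (proj₁ (covT x) c)) , (λ q → proj₂ (covT x) (Q⊆P q))

coverable-leaf : a < b → Empty P → Coverable 0 a b P
coverable-leaf a<b empty = leaf , z≤n , λ x →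
  (λ (a≡x , b≡x) → ⊥-elim (<-irrefl (trans a≡x (sym b≡x)) a<b)) , (λ Px → ⊥-elim (empty x Px))

coverable-singleton : Coverable 0 a a (Icc a a)
coverable-singleton = leaf , z≤n , λ x →
  (λ { (refl , _) → ≤-refl , ≤-refl }) , (λ (a≤x , x≤a) → ≤-antisym a≤x x≤a , ≤-antisym a≤x x≤a)

coverable-node : a ≤ e → e < b → Coverable h a e P → Coverable h (suc e) b Q → Coverable (suc h) a b (P ∪ Q)
coverable-node {e = e} a≤e e<b (L , hL , covL) (R , hR , covR) =
  node e a≤e e<b L R , s≤s (⊔-lub hL hR) ,
  λ x → Sum.map (proj₁ (covL x)) (proj₁ (covR x)) , Sum.map (proj₂ (covL x)) (proj₂ (covR x))

cover-Icc : ∀ h → a ≤ b → b ≤ a + mersenne h → Coverable h a b (Icc a b)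
cover-Icc {a} zero a≤b b≤a+0 with ≤-antisym a≤b (subst (_ ≤_) (+-identityʳ a) b≤a+0)
... | refl = coverable-singleton
cover-Icc {a} {b} (suc h) a≤b b≤ with b ≤? a + mersenne h
... | yes b≤a+p = coverable-mono (n≤1+n h) (cover-Icc h a≤b b≤a+p)
... | no b≰a+p = coverable-≐ (≐-sym (Icc-split (m≤n⇒m≤1+n a≤a+p) (<⇒≤ a+p<b)))
                   (coverable-node a≤a+p a+p<b (cover-Icc h a≤a+p ≤-refl) (cover-Icc h a+p<b b≤1+a+p+p))
  where
  p = mersenne h
  a≤a+p = m≤m+n a p
  a+p<b = ≰⇒> b≰a+p
  b≤1+a+p+p : b ≤ suc (a + p) + p
  b≤1+a+p+p = subst (b ≤_) (lemma a p) b≤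
    where
    lemma : ∀ a p → a + suc (p + p) ≡ suc (a + p) + p
    lemma = solve-∀

coverable-prepend : a ≤ e → e ≤ a + mersenne h → e < l → e < b →
                    Coverable h (suc e) b (Ico (suc e) l ∪ P) → Coverable (suc h) a b (Ico a l ∪ P)
coverable-prepend {h = h} a≤e e≤ e<l e<b cov =
  coverable-≐ (≐-trans (≐-sym (∪-assoc _ _ _)) (∪-cong (≐-sym (Ico-split (m≤n⇒m≤1+n a≤e) e<l)) ≐-refl))
    (coverable-node a≤e e<b (cover-Icc h a≤e e≤) cov)

coverable-append : a ≤ r → r ≤ e → e ≤ b → b ≤ suc e + mersenne h →
                   Coverable h a e (P ∪ Ioc r e) → Coverable (suc h) a b (P ∪ Ioc r b)
coverable-append {h = h} a≤r r≤e e≤b b≤ cov with m≤n⇒m<n∨m≡n e≤b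
... | inj₂ refl = coverable-mono (n≤1+n h) cov
... | inj₁ e<b = coverable-≐ (≐-trans (∪-assoc _ _ _) (∪-cong ≐-refl (≐-sym (Icc-split (s≤s r≤e) (<⇒≤ e<b)))))
                   (coverable-node (≤-trans a≤r r≤e) e<b cov (cover-Icc h e<b b≤))

-- The gap [a + A, r] has at least two vertices, so a leaf can be placed inside it without covering anything.
cover-gap : ∀ h {a A r B} → a + A < r → A + B ≤ mersenne h →
            Coverable h a (r + B) (Ico a (a + A) ∪ Ioc r (r + B))
cover-gap zero {a} {zero} {r} {zero} a+0<r _ =
  coverable-leaf (<-≤-trans (≤-<-trans (m≤m+n a 0) a+0<r) (m≤m+n r 0))
    λ x → [ Ico-Empty (≤-reflexive (+-identityʳ a)) x , Ioc-Empty (≤-reflexive (+-identityʳ r)) x ]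
cover-gap (suc h) {a} {A} {r} {B} a+A<r A+B≤ with A ≤? mersenne h
... | yes A≤p =
  coverable-append (≤-trans (m≤m+n a A) (<⇒≤ a+A<r)) (m≤m+n r B′) (+-monoʳ-≤ r (m∸n≤m B (suc p))) B≤
    (cover-gap h a+A<r (m+[n∸o]≤p (suc p) A≤p A+B≤))
  where
  p = mersenne h
  B′ = B ∸ suc p
  B≤ : r + B ≤ suc (r + B′) + p
  B≤ = ≤-trans (+-monoʳ-≤ r (m≤n+m∸n B (suc p))) (≤-reflexive (+-suc-comm r p B′))
    where
    +-suc-comm : ∀ r p B′ → r + (suc p + B′) ≡ suc (r + B′) + p
    +-suc-comm = solve-∀
... | no A≰p with m≤n⇒∃[o]m+o≡n (≰⇒> A≰p)
...   | A′ , refl =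
  coverable-prepend (m≤m+n a p) ≤-refl a+p<a+A (<-≤-trans a+p<a+A (≤-trans (<⇒≤ a+A<r) (m≤m+n r B)))
    (subst (λ l → Coverable h (suc (a + p)) (r + B) (Ico (suc (a + p)) l ∪ Ioc r (r + B))) a+A≡
      (cover-gap h (subst (_< r) (sym a+A≡) a+A<r)
         (+-cancelˡ-≤ (suc p) _ _ (subst (_≤ suc p + p) (+-assoc (suc p) A′ B) A+B≤))))
  where
  p = mersenne h
  a+p<a+A : a + p < a + (suc p + A′)
  a+p<a+A = +-monoʳ-< a (s≤s (m≤m+n p A′))
  a+A≡ : suc (a + p) + A′ ≡ a + (suc p + A′)
  a+A≡ = +-suc-assoc a p A′
    where
    +-suc-assoc : ∀ a p A′ → suc (a + p) + A′ ≡ a + (suc p + A′)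
    +-suc-assoc = solve-∀

cover-prefix : ∀ h {a A b} → a + A < b → A ≤ mersenne h → Coverable h a b (Ico a (a + A))
cover-prefix h {a} {A} {b} a+A<b A≤p =
  subst (λ b → Coverable h a b (Ico a (a + A))) (+-identityʳ b)
    (coverable-≐ (∪-identityʳ-Empty (Ioc-Empty (≤-reflexive (+-identityʳ b))))
      (cover-gap h a+A<b (subst (_≤ mersenne h) (sym (+-identityʳ A)) A≤p)))

cover-suffix : ∀ h {a r B} → a < r → B ≤ mersenne h → Coverable h a (r + B) (Ioc r (r + B))
cover-suffix h {a} a<r B≤p =
  coverable-≐ (∪-identityˡ-Empty (Ico-Empty (≤-reflexive (+-identityʳ a))))
    (cover-gap h (subst (_< _) (sym (+-identityʳ a)) a<r) B≤p)

[n+m]%n≡m : ∀ {m n} .{{_ : NonZero n}} → m < n → (n + m) % n ≡ m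
[n+m]%n≡m {m} {n} m<n = trans (cong (_% n) (+-comm n m)) (trans ([m+n]%n≡m%n m n) (m<n⇒m%n≡m m<n))

InInterval-≐-Icc : ∀ {n v w} .{{_ : NonZero n}} → w < n → InInterval n v w ≐ Icc v w
InInterval-≐-Icc {v = v} {w} w<n =
  (λ { (_ , z , v≤z , z≤w , refl) → subst (Icc v w) (sym (m<n⇒m%n≡m (≤-<-trans z≤w w<n))) (v≤z , z≤w) }) ,
  (λ (v≤x , x≤w) → ≤-trans v≤x x≤w , _ , v≤x , x≤w , m<n⇒m%n≡m (≤-<-trans x≤w w<n))

InInterval-≐-wrap : ∀ {m v A} → v ≤ m → A ≤ v → InInterval (suc m) v (m + A) ≐ Ico 0 A ∪ Icc v m
InInterval-≐-wrap {m} {v} {A} v≤m A≤v =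
  (λ { (_ , z , v≤z , z≤m+A , refl) → reduce v≤z z≤m+A }) ,
  (λ {x} → [ (λ (_ , x<A) → lift x<A) , (λ (v≤x , x≤m) → v≤m+A , x , v≤x , ≤-trans x≤m (m≤m+n m A) , m<n⇒m%n≡m (s≤s x≤m)) ])
  where
  v≤m+A = ≤-trans v≤m (m≤m+n m A)
  A<1+m = s≤s (≤-trans A≤v v≤m)
  lift : ∀ {x} → x < A → InInterval (suc m) v (m + A) x
  lift {x} x<A = v≤m+A , suc m + x , ≤-trans v≤m (≤-trans (n≤1+n m) (m≤m+n (suc m) x)) ,
                 subst (_≤ m + A) (+-suc m x) (+-monoʳ-≤ m x<A) , [n+m]%n≡m (<-trans x<A A<1+m)
  reduce : ∀ {z} → v ≤ z → z ≤ m + A → (Ico 0 A ∪ Icc v m) (z % suc m)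
  reduce {z} v≤z z≤m+A with z ≤? m
  ... | yes z≤m = inj₂ (subst (Icc v m) (sym (m<n⇒m%n≡m (s≤s z≤m))) (v≤z , z≤m))
  ... | no z≰m with m≤n⇒∃[o]m+o≡n (≰⇒> z≰m)
  ...   | y , refl = inj₁ (subst (Ico 0 A) (sym ([n+m]%n≡m (<-trans y<A A<1+m))) (z≤n , y<A))
    where
    y<A : y < A
    y<A = +-cancelˡ-< m y A z≤m+A

MeetsEnds : ℕ → Pred ℕ 0ℓ → Set
MeetsEnds n S = S 0 ⊎ S (n ∸ 1)

SegmentStrategy : (n : ℕ) .{{_ : NonZero n}} → ℕ → ℕ → ℕ → Set
SegmentStrategy n k v c = Σ (StrategyG n) λ T → height T ≤ k ×
  (MeetsEnds n (InSeg n v (c + 1)) → CoveredSetIs T (InSeg n v (c + 1))) ×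
  (¬ MeetsEnds n (InSeg n v (c + 1)) → CoveredSetIs T (InSeg n v c))

InSeg-+1 : ∀ n .{{_ : NonZero n}} v c → InSeg n v (c + 1) ≡ InInterval n v (v + c)
InSeg-+1 n v c = cong (InInterval n v) (trans (cong (_∸ 1) (sym (+-assoc v c 1))) (m+n∸n≡m (v + c) 1))

segment-meeting : ∀ {n} .{{_ : NonZero n}} {k v c} → MeetsEnds n (InInterval n v (v + c)) →
                  Coverable k 0 (n ∸ 1) (InInterval n v (v + c)) → SegmentStrategy n k v c
segment-meeting {n} {k = k} {v} {c} meets cov =
  let T , hT , covT = subst (Coverable k 0 (n ∸ 1)) (sym (InSeg-+1 n v c)) cov
  in T , hT , (λ _ → covT) , (λ misses → ⊥-elim (misses (subst (MeetsEnds n) (sym (InSeg-+1 n v c)) meets)))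

segment-missing : ∀ {n} .{{_ : NonZero n}} {k v c} → ¬ MeetsEnds n (InInterval n v (v + c)) →
                  Coverable k 0 (n ∸ 1) (InSeg n v c) → SegmentStrategy n k v c
segment-missing {n} {v = v} {c} misses (T , hT , covT) =
  T , hT , (λ meets → ⊥-elim (misses (subst (MeetsEnds n) (InSeg-+1 n v c) meets))) , (λ _ → covT)

segment-start : ∀ {m c} → suc c ≤ mersenne k → suc c < m → SegmentStrategy (suc m) k 0 c
segment-start {k} {m} {c} c+1≤ c+1<m =
  segment-meeting (inj₁ (proj₂ S≐Icc (z≤n , z≤n)))
    (coverable-≐ (≐-trans Ico-suc (≐-sym S≐Icc)) (cover-prefix k c+1<m c+1≤))
  where
  S≐Icc : InInterval (suc m) 0 c ≐ Icc 0 c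
  S≐Icc = InInterval-≐-Icc (m<n⇒m<1+n (<-trans (n<1+n c) c+1<m))

segment-wrap : ∀ {m c v′} → suc c ≤ mersenne k → suc c < m → v′ < m → m ≤ suc v′ + c →
               SegmentStrategy (suc m) k (suc v′) c
segment-wrap {k} {m} {c} {v′} c+1≤ c+1<m v′<m m≤v+c with m≤n⇒∃[o]m+o≡n (<⇒≤ v′<m)
... | B , refl =
  segment-meeting (inj₂ (proj₂ S≐ (inj₂ (v′<m , ≤-refl))))
    (coverable-≐ (≐-sym S≐) (cover-gap k A<v′ (subst (_≤ mersenne k) (sym A+B≡) c+1≤)))
  where
  A = suc c ∸ B
  B+A≡ : B + A ≡ suc c
  B+A≡ = m+[n∸m]≡n (+-cancelˡ-≤ v′ B (suc c) (subst (v′ + B ≤_) (sym (+-suc v′ c)) m≤v+c))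
  A+B≡ : A + B ≡ suc c
  A+B≡ = trans (+-comm A B) B+A≡
  A<v′ : A < v′
  A<v′ = +-cancelʳ-< B A v′ (subst (_< v′ + B) (sym A+B≡) c+1<m)
  end≡ : v′ + B + A ≡ suc v′ + c
  end≡ = begin
    v′ + B + A   ≡⟨ +-assoc v′ B A ⟩
    v′ + (B + A) ≡⟨ cong (v′ +_) B+A≡ ⟩
    v′ + suc c   ≡⟨ +-suc v′ c ⟩
    suc v′ + c   ∎
    where open ≡-Reasoning
  S≐ : InInterval (suc (v′ + B)) (suc v′) (suc v′ + c) ≐ Ico 0 A ∪ Icc (suc v′) (v′ + B)
  S≐ = subst (λ w → InInterval (suc (v′ + B)) (suc v′) w ≐ Ico 0 A ∪ Icc (suc v′) (v′ + B)) end≡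
         (InInterval-≐-wrap v′<m (≤-trans (<⇒≤ A<v′) (n≤1+n v′)))

segment-inner : ∀ {m H v′} → H ≤ mersenne h → 0 < v′ → suc v′ + (H + H) < m →
                SegmentStrategy (suc m) (suc h) (suc v′) (H + H)
segment-inner {h} {m} {H} {v′} H≤ 0<v′ v+c<m = segment-missing misses (coverable-≐ (≐-sym T≐) halves)
  where
  c = H + H
  S≐ : InInterval (suc m) (suc v′) (suc v′ + c) ≐ Icc (suc v′) (suc v′ + c)
  S≐ = InInterval-≐-Icc (m<n⇒m<1+n v+c<m)
  misses : ¬ MeetsEnds (suc m) (InInterval (suc m) (suc v′) (suc v′ + c))
  misses = [ (λ s → n≮0 (proj₁ (proj₁ S≐ s))) , (λ s → <⇒≱ v+c<m (proj₂ (proj₁ S≐ s))) ]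
  T≐ : InInterval (suc m) (suc v′) (v′ + c) ≐ Icc (suc v′) (v′ + c)
  T≐ = InInterval-≐-Icc (<-trans (n<1+n (v′ + c)) (m<n⇒m<1+n v+c<m))
  v+H+H<m : suc (v′ + H) + H < m
  v+H+H<m = subst (_< m) (cong suc (sym (+-assoc v′ H H))) v+c<m
  glue : Ioc v′ (v′ + H) ∪ Ico (suc (v′ + H)) (suc (v′ + H + H)) ≐ Icc (suc v′) (v′ + H + H)
  glue = ≐-trans (∪-cong ≐-refl Ico-suc) (≐-sym (Icc-split (s≤s (m≤m+n v′ H)) (m≤m+n (v′ + H) H)))
  halves : Coverable (suc h) 0 m (Icc (suc v′) (v′ + c))
  halves = subst (λ w → Coverable (suc h) 0 m (Icc (suc v′) w)) (+-assoc v′ H H)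
             (coverable-≐ glue (coverable-node z≤n (≤-trans (s≤s (m≤m+n (v′ + H) H)) (<⇒≤ v+H+H<m))
               (cover-suffix h 0<v′ H≤) (cover-prefix h v+H+H<m H≤)))

corollary3p1 : (k n : ℕ) → .{{_ : NonZero n}} → 2 ≤ k → 2 ^ k < n →
    (v : ℕ) → v < n → ¬ (v ≡ 1) →
    Σ (StrategyG n) λ T → (height T ≤ k) ×
      ((InSeg n v ((2 ^ k ∸ 2) + 1) 0 ⊎ InSeg n v ((2 ^ k ∸ 2) + 1) (n ∸ 1)) →
         CoveredSetIs T (InSeg n v ((2 ^ k ∸ 2) + 1))) ×
      (¬ (InSeg n v ((2 ^ k ∸ 2) + 1) 0 ⊎ InSeg n v ((2 ^ k ∸ 2) + 1) (n ∸ 1)) →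
         CoveredSetIs T (InSeg n v (2 ^ k ∸ 2)))
corollary3p1 (suc h) (suc m) (s≤s _) 2^k<n v v<n v≢1 =
  subst (SegmentStrategy (suc m) (suc h) v) c≡ (by-cases v v<n v≢1)
  where
  c = mersenne h + mersenne h
  2^k≡ : 2 ^ suc h ≡ suc (suc c)
  2^k≡ = 2^≡1+mersenne (suc h)
  c≡ : c ≡ 2 ^ suc h ∸ 2
  c≡ = cong (_∸ 2) (sym 2^k≡)
  c+1<m : suc c < m
  c+1<m = ≤-pred (subst (_< suc m) 2^k≡ 2^k<n)
  by-cases : ∀ v → v < suc m → ¬ v ≡ 1 → SegmentStrategy (suc m) (suc h) v c
  by-cases zero _ _ = segment-start ≤-refl c+1<m
  by-cases (suc zero) _ v≢1 = ⊥-elim (v≢1 refl)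
  by-cases (suc v′@(suc _)) v<n _ with m ≤? suc v′ + c
  ... | yes reaches = segment-wrap ≤-refl c+1<m (≤-pred v<n) reaches
  ... | no misses = segment-inner ≤-refl (s≤s z≤n) (≰⇒> misses)
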